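{- Let $\tau:\Sigma\to\Theta$ be a translation between relational signatures. Then for every $\Sigma$-formula $A$: $\rho_\exists(A^\tau) \le \rho_\exists(A) + \rho^\ast(\tau)$ and $\rho_\forall(A^\tau) \le \rho_\forall(A) + \rho^\ast(\tau)$.
   Context: Complexity: $\rho_\exists,\rho_\forall$ on formulas built from atoms (including $\top,\bot$) with $\neg,\wedge,\vee,\to,\exists,\forall$: atoms get $1$; $\rho_\exists(\neg B)=\rho_\forall(B)$, $\rho_\forall(\neg B)=\rho_\exists(B)$; $\rho_\exists(B\circ C)=\max(\rho_\exists(B),\rho_\exists(C))$ and $\rho_\forall(B\circ C)=\max(\rho_\forall(B),\rho_\forall(C))$ for $\circ\in\{\wedge,\vee\}$; $\rho_\exists(B\to C)=\max(\rho_\forall(B),\rho_\exists(C))$, $\rho_\forall(B\to C)=\max(\rho_\exists(B),\rho_\forall(C))$; $\rho_\exists(\exists vB)=\rho_\exists(B)$, $\rho_\forall(\exists vB)=\rho_\exists(B)+1$; $\rho_\exists(\forall vB)=\rho_\forall(B)+1$, $\rho_\forall(\forall vB)=\rho_\forall(B)$; $\rho_0=\max(\rho_\exists,\rho_\forall)$. An $m$-dimensional translation $\tau:\Sigma\to\Theta$ consists of a $\Theta$-formula $\delta_\tau(v_0,\dots,v_{m-1})$ and, for each $n$-ary predicate $P$ of $\Sigma$ (identity possibly included), a $\Theta$-formula $P_\tau(\vec v_0,\dots,\vec v_{n-1})$ on $m$-tuples of variables, with $\vdash P_\tau(\vec v_0,\ldots)\to\bigwedge_i\delta_\tau(\vec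 v_i)$. $A^\tau$ is defined by $P(x_0,\dots,x_{n-1})^\tau = P_\tau(\vec x_0,\dots,\vec x_{n-1})$, commuting with connectives, $(\forall x A)^\tau=\forall\vec x(\delta_\tau(\vec x)\to A^\tau)$ and $(\exists xA)^\tau=\exists\vec x(\delta_\tau(\vec x)\wedge A^\tau)$. $\rho^\ast(\tau)$ is the maximum of $\rho_0(\delta_\tau)$ and the $\rho_0(P_\tau)$ for $P$ in $\Sigma$. -}

module Defs where

open import Data.Nat using (ℕ; zero; suc; _+_; _*_; _⊔_; NonZero)
open import Data.Fin using (Fin; zero; suc; _↑ˡ_; _↑ʳ_; combine; remQuot)
open import Data.Product using (_×_; _,_)

-- Relational signatures: finitely many predicate symbols, each with an
-- arity.  Identity, when present, is just one of the (binary) predicates.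

record Signature : Set where
  field
    numPreds : ℕ
    arity    : Fin numPreds → ℕ
open Signature public

data Formula (Σ : Signature) : ℕ → Set where
  atom : ∀ {n} (P : Fin (numPreds Σ)) → (Fin (arity Σ P) → Fin n) → Formula Σ n
  ⊤′ ⊥′ : ∀ {n} → Formula Σ n
  ¬′_ : ∀ {n} → Formula Σ n → Formula Σ n
  _∧′_ _∨′_ _⇒′_ : ∀ {n} → Formula Σ n → Formula Σ n → Formula Σ n
  ∃′ ∀′ : ∀ {n} → Formula Σ (suc n) → Formula Σ n

mutual
  ρ∃ : ∀ {Σ n} → Formula Σ n → ℕ
  ρ∃ (atom P xs) = 1
  ρ∃ ⊤′ = 1
  ρ∃ ⊥′ = 1
  ρ∃ (¬′ B) = ρ∀ B
  ρ∃ (B ∧′ C) = ρ∃ B ⊔ ρ∃ C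
  ρ∃ (B ∨′ C) = ρ∃ B ⊔ ρ∃ C
  ρ∃ (B ⇒′ C) = ρ∀ B ⊔ ρ∃ C
  ρ∃ (∃′ B) = ρ∃ B
  ρ∃ (∀′ B) = suc (ρ∀ B)

  ρ∀ : ∀ {Σ n} → Formula Σ n → ℕ
  ρ∀ (atom P xs) = 1
  ρ∀ ⊤′ = 1
  ρ∀ ⊥′ = 1
  ρ∀ (¬′ B) = ρ∃ B
  ρ∀ (B ∧′ C) = ρ∀ B ⊔ ρ∀ C
  ρ∀ (B ∨′ C) = ρ∀ B ⊔ ρ∀ C
  ρ∀ (B ⇒′ C) = ρ∃ B ⊔ ρ∀ C
  ρ∀ (∃′ B) = suc (ρ∃ B)
  ρ∀ (∀′ B) = ρ∀ B

ρ₀ : ∀ {Σ n} → Formula Σ n → ℕ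
ρ₀ A = ρ∃ A ⊔ ρ∀ A

lift : ∀ {a b} → (Fin a → Fin b) → Fin (suc a) → Fin (suc b)
lift f zero = zero
lift f (suc i) = suc (f i)

rename : ∀ {Σ a b} → (Fin a → Fin b) → Formula Σ a → Formula Σ b
rename f (atom P xs) = atom P (λ i → f (xs i))
rename f ⊤′ = ⊤′
rename f ⊥′ = ⊥′
rename f (¬′ B) = ¬′ rename f B
rename f (B ∧′ C) = rename f B ∧′ rename f C
rename f (B ∨′ C) = rename f B ∨′ rename f C
rename f (B ⇒′ C) = rename f B ⇒′ rename f C
rename f (∃′ B) = ∃′ (rename (lift f) B)
rename f (∀′ B) = ∀′ (rename (lift f) B)

∀ⁿ : ∀ {Σ n} m → Formula Σ (m + n) → Formula Σ n
∀ⁿ zero A = A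
∀ⁿ (suc m) A = ∀ⁿ m (∀′ A)

∃ⁿ : ∀ {Σ n} m → Formula Σ (m + n) → Formula Σ n
∃ⁿ zero A = A
∃ⁿ (suc m) A = ∃ⁿ m (∃′ A)

⋀ : ∀ {Σ a} n → (Fin n → Formula Σ a) → Formula Σ a
⋀ zero F = ⊤′
⋀ (suc zero) F = F zero
⋀ (suc (suc n)) F = F zero ∧′ ⋀ (suc n) (λ i → F (suc i))

-- A Σ-variable x (among k) is sent to the m-tuple of Θ-variables
-- combine x 0 , … , combine x (m-1)   (among k * m).
-- δ has free variables v_0 … v_{m-1};  P_τ has free variables the n
-- consecutive m-tuples  v⃗_0 … v⃗_{n-1}  (n * m variables).
-- Derivability ⊢ in Θ is a parameter (the paper's first-order ⊢).

record Translation (Σ Θ : Signature) (⊢_ : ∀ {a} → Formula Θ a → Set) : Set where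
  field
    dim      : ℕ
    .{{dim-nonzero}} : NonZero dim
    δ        : Formula Θ dim
    predT    : (P : Fin (numPreds Σ)) → Formula Θ (arity Σ P * dim)
    predT-δ  : (P : Fin (numPreds Σ)) →
               ⊢ (predT P ⇒′ ⋀ (arity Σ P) (λ i → rename (λ j → combine i j) δ))
open Translation public

module _ {Σ Θ : Signature} {⊢_ : ∀ {a} → Formula Θ a → Set}
         (τ : Translation Σ Θ ⊢_) where

  private
    m = dim τ

  _^τ : ∀ {k} → Formula Σ k → Formula Θ (k * m)
  atom P xs ^τ =
    rename (λ i → let (a , j) = remQuot {arity Σ P} m i in combine (xs a) j) (predT τ P)
  ⊤′ ^τ = ⊤′
  ⊥′ ^τ = ⊥′
  (¬′ B) ^τ = ¬′ (B ^τ)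
  (B ∧′ C) ^τ = (B ^τ) ∧′ (C ^τ)
  (B ∨′ C) ^τ = (B ^τ) ∨′ (C ^τ)
  (B ⇒′ C) ^τ = (B ^τ) ⇒′ (C ^τ)
  (∃′ {k} B) ^τ = ∃ⁿ m (rename (λ j → j ↑ˡ (k * m)) (δ τ) ∧′ (B ^τ))
  (∀′ {k} B) ^τ = ∀ⁿ m (rename (λ j → j ↑ˡ (k * m)) (δ τ) ⇒′ (B ^τ))

maxFin : ∀ n → (Fin n → ℕ) → ℕ
maxFin zero f = 0
maxFin (suc n) f = f zero ⊔ maxFin n (λ i → f (suc i))

ρ* : ∀ {Σ Θ : Signature} {⊢_ : ∀ {a} → Formula Θ a → Set} → Translation Σ Θ ⊢_ → ℕ
ρ* {Σ} τ = ρ₀ (δ τ) ⊔ maxFin (numPreds Σ) (λ P → ρ₀ (predT τ P))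

module Submission where

open import Defs
open import Data.Nat using (ℕ; _+_; _≤_; suc; _⊔_; NonZero; s≤s)
open import Data.Nat.Properties
  using ( module ≤-Reasoning; ≤-trans; ≤-reflexive; m≤m⊔n; m≤n⊔m; ⊔-mono-≤; ⊔-lub
        ; +-distribʳ-⊔; m≤m+n; m≤n+m )
open import Data.Fin using (Fin; zero; suc)
open import Data.Product using (_×_; _,_; proj₁; proj₂)
open import Relation.Binary.PropositionalEquality using (_≡_; refl; sym; cong; cong₂)

-- Renaming preserves ρ∃ and ρ∀, so an atom becomes a copy of some P_τ, of
-- complexity at most ρ*(τ). Connectives commute with ^τ and ρ∃, ρ∀ are built from them by ⊔, so
-- the bound passes through. A quantifier ∃x B becomes a block of m ≥ 1 existentials over
-- δ_τ ∧ B^τ; such a block is invisible to ρ∃ and costs exactly one unit in ρ∀, matching the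
-- unit that ∃ itself costs in ρ∀ (dually for ∀, with δ_τ ⇒ B^τ).

ρ-rename : ∀ {Σ a b} (f : Fin a → Fin b) (A : Formula Σ a) →
  (ρ∃ (rename f A) ≡ ρ∃ A) × (ρ∀ (rename f A) ≡ ρ∀ A)
ρ-rename f (atom P xs) = refl , refl
ρ-rename f ⊤′ = refl , refl
ρ-rename f ⊥′ = refl , refl
ρ-rename f (¬′ A) = let (e , u) = ρ-rename f A in u , e
ρ-rename f (A ∧′ B) =
  let (e , u) = ρ-rename f A ; (e′ , u′) = ρ-rename f B in cong₂ _⊔_ e e′ , cong₂ _⊔_ u u′
ρ-rename f (A ∨′ B) =
  let (e , u) = ρ-rename f A ; (e′ , u′) = ρ-rename f B in cong₂ _⊔_ e e′ , cong₂ _⊔_ u u′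
ρ-rename f (A ⇒′ B) =
  let (e , u) = ρ-rename f A ; (e′ , u′) = ρ-rename f B in cong₂ _⊔_ u e′ , cong₂ _⊔_ e u′
ρ-rename f (∃′ A) = let (e , _) = ρ-rename (lift f) A in e , cong suc e
ρ-rename f (∀′ A) = let (_ , u) = ρ-rename (lift f) A in cong suc u , u

ρ₀-rename : ∀ {Σ a b} (f : Fin a → Fin b) (A : Formula Σ a) → ρ₀ (rename f A) ≡ ρ₀ A
ρ₀-rename f A = let (e , u) = ρ-rename f A in cong₂ _⊔_ e u

ρ∃-≤-ρ₀ : ∀ {Σ a} (A : Formula Σ a) → ρ∃ A ≤ ρ₀ A
ρ∃-≤-ρ₀ A = m≤m⊔n _ _

ρ∀-≤-ρ₀ : ∀ {Σ a} (A : Formula Σ a) → ρ∀ A ≤ ρ₀ A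
ρ∀-≤-ρ₀ A = m≤n⊔m _ _

ρ∃-∃ⁿ : ∀ {Σ n} m (A : Formula Σ (m + n)) → ρ∃ (∃ⁿ m A) ≡ ρ∃ A
ρ∃-∃ⁿ 0 A = refl
ρ∃-∃ⁿ (suc m) A = ρ∃-∃ⁿ m (∃′ A)

ρ∀-∀ⁿ : ∀ {Σ n} m (A : Formula Σ (m + n)) → ρ∀ (∀ⁿ m A) ≡ ρ∀ A
ρ∀-∀ⁿ 0 A = refl
ρ∀-∀ⁿ (suc m) A = ρ∀-∀ⁿ m (∀′ A)

ρ∀-∃ⁿ : ∀ {Σ n} m .{{_ : NonZero m}} (A : Formula Σ (m + n)) → ρ∀ (∃ⁿ m A) ≡ suc (ρ∃ A)
ρ∀-∃ⁿ 1 A = refl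
ρ∀-∃ⁿ (suc (suc m)) A = ρ∀-∃ⁿ (suc m) (∃′ A)

ρ∃-∀ⁿ : ∀ {Σ n} m .{{_ : NonZero m}} (A : Formula Σ (m + n)) → ρ∃ (∀ⁿ m A) ≡ suc (ρ∀ A)
ρ∃-∀ⁿ 1 A = refl
ρ∃-∀ⁿ (suc (suc m)) A = ρ∃-∀ⁿ (suc m) (∀′ A)

maxFin-upper : ∀ n (f : Fin n → ℕ) (i : Fin n) → f i ≤ maxFin n f
maxFin-upper (suc n) f zero = m≤m⊔n _ _
maxFin-upper (suc n) f (suc i) = ≤-trans (maxFin-upper n (λ j → f (suc j)) i) (m≤n⊔m _ _)

⊔-mono-+ʳ : ∀ {a b c d} r → a ≤ b + r → c ≤ d + r → a ⊔ c ≤ (b ⊔ d) + r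
⊔-mono-+ʳ {b = b} {d = d} r p q = ≤-trans (⊔-mono-≤ p q) (≤-reflexive (sym (+-distribʳ-⊔ r b d)))

module _ {Σ Θ : Signature} {⊢_ : ∀ {a} → Formula Θ a → Set} (τ : Translation Σ Θ ⊢_) where

  ρ₀-δ≤ρ* : ρ₀ (δ τ) ≤ ρ* τ
  ρ₀-δ≤ρ* = m≤m⊔n _ _

  ρ₀-predT≤ρ* : ∀ P → ρ₀ (predT τ P) ≤ ρ* τ
  ρ₀-predT≤ρ* P =
    ≤-trans (maxFin-upper (numPreds Σ) (λ Q → ρ₀ (predT τ Q)) P) (m≤n⊔m (ρ₀ (δ τ)) _)

  ρ∃-rename-δ≤ : ∀ {b} (f : Fin (dim τ) → Fin b) c → ρ∃ (rename f (δ τ)) ≤ c + ρ* τ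
  ρ∃-rename-δ≤ f c = begin
    ρ∃ (rename f (δ τ)) ≡⟨ proj₁ (ρ-rename f (δ τ)) ⟩
    ρ∃ (δ τ)            ≤⟨ ρ∃-≤-ρ₀ (δ τ) ⟩
    ρ₀ (δ τ)            ≤⟨ ρ₀-δ≤ρ* ⟩
    ρ* τ                ≤⟨ m≤n+m _ c ⟩
    c + ρ* τ            ∎
    where open ≤-Reasoning

  ρ-^τ-≤ : ∀ {k} (A : Formula Σ k) →
    (ρ∃ (_^τ τ A) ≤ ρ∃ A + ρ* τ) × (ρ∀ (_^τ τ A) ≤ ρ∀ A + ρ* τ)
  ρ-^τ-≤ (atom P xs) =
    ≤-trans (ρ∃-≤-ρ₀ (_^τ τ (atom P xs))) ρ₀-atom^τ≤ ,
    ≤-trans (ρ∀-≤-ρ₀ (_^τ τ (atom P xs))) ρ₀-atom^τ≤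
    where
    ρ₀-atom^τ≤ : ρ₀ (_^τ τ (atom P xs)) ≤ 1 + ρ* τ
    ρ₀-atom^τ≤ = ≤-trans (≤-reflexive (ρ₀-rename _ (predT τ P))) (≤-trans (ρ₀-predT≤ρ* P) (m≤n+m _ 1))
  ρ-^τ-≤ ⊤′ = m≤m+n 1 _ , m≤m+n 1 _
  ρ-^τ-≤ ⊥′ = m≤m+n 1 _ , m≤m+n 1 _
  ρ-^τ-≤ (¬′ A) = let (e , u) = ρ-^τ-≤ A in u , e
  ρ-^τ-≤ (A ∧′ B) =
    let (e , u) = ρ-^τ-≤ A ; (e′ , u′) = ρ-^τ-≤ B in ⊔-mono-+ʳ (ρ* τ) e e′ , ⊔-mono-+ʳ (ρ* τ) u u′
  ρ-^τ-≤ (A ∨′ B) =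
    let (e , u) = ρ-^τ-≤ A ; (e′ , u′) = ρ-^τ-≤ B in ⊔-mono-+ʳ (ρ* τ) e e′ , ⊔-mono-+ʳ (ρ* τ) u u′
  ρ-^τ-≤ (A ⇒′ B) =
    let (e , u) = ρ-^τ-≤ A ; (e′ , u′) = ρ-^τ-≤ B in ⊔-mono-+ʳ (ρ* τ) u e′ , ⊔-mono-+ʳ (ρ* τ) e u′
  ρ-^τ-≤ (∃′ A) =
    ≤-trans (≤-reflexive (ρ∃-∃ⁿ (dim τ) guarded)) guarded≤ ,
    ≤-trans (≤-reflexive (ρ∀-∃ⁿ (dim τ) guarded)) (s≤s guarded≤)
    where
    guarded = rename _ (δ τ) ∧′ _^τ τ A
    guarded≤ : ρ∃ guarded ≤ ρ∃ A + ρ* τ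
    guarded≤ = ⊔-lub (ρ∃-rename-δ≤ _ (ρ∃ A)) (proj₁ (ρ-^τ-≤ A))
  ρ-^τ-≤ (∀′ A) =
    ≤-trans (≤-reflexive (ρ∃-∀ⁿ (dim τ) guarded)) (s≤s guarded≤) ,
    ≤-trans (≤-reflexive (ρ∀-∀ⁿ (dim τ) guarded)) guarded≤
    where
    guarded = rename _ (δ τ) ⇒′ _^τ τ A
    guarded≤ : ρ∀ guarded ≤ ρ∀ A + ρ* τ
    guarded≤ = ⊔-lub (ρ∃-rename-δ≤ _ (ρ∀ A)) (proj₂ (ρ-^τ-≤ A))

mainTheorem17 : {Σ Θ : Signature} {⊢_ : ∀ {a} → Formula Θ a → Set}
    (τ : Translation Σ Θ ⊢_) {k : ℕ} (A : Formula Σ k) →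
    (ρ∃ (_^τ τ A) ≤ ρ∃ A + ρ* τ) × (ρ∀ (_^τ τ A) ≤ ρ∀ A + ρ* τ)
mainTheorem17 = ρ-^τ-≤
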